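{- Let $\Lambda$ be a ring with identity and $A,B,C\in\Lambda$. Then in $\Lambda[[z]]$: (1) $M_0=1+J_0+J_0^2+\cdots$; (2) $G(w)=M_0-M_1M_0^{ -1}M_{ -1}$.
   Context: A walk of length $l\ge0$ is an $(l+1)$-tuple $\alpha=(\alpha_0,\dots,\alpha_l)$ of integers with each $\alpha_i-\alpha_{i-1}\in\{ -1,0,1\}$; it is a walk from $\alpha_0$ to $\alpha_l$. Its weight is $w(\alpha)=1$ if $l=0$, and otherwise $w(\alpha)=U_1\cdots U_l$ with $U_i=A,B,C$ according as $\alpha_i-\alpha_{i-1}=-1,0,1$. A walk is standard if $\alpha_i\ge\alpha_l$ for all $i$; it is primitive if $l>0$, $\alpha_0=\alpha_l$ and no $\alpha_i$ with $0<i<l$ equals $\alpha_0$. $G(w)=\sum w(\alpha)z^{l(\alpha)}$ over all standard walks from $0$ to $0$. $M_0=\sum w(\alpha)z^{l(\alpha)}$ over all walks from $0$ to $0$; $M_{ -1}$ is the same sum over all walks from $-1$ to $0$; $M_1$ the same sum over all walks from $1$ to $0$; $J_0$ the same sum over all primitive walks from $0$ to $0$. ($M_0$ has constant term $1$, hence is invertible in $\Lambda[[z]]$.) -}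

module Defs where

open import Level using (Level)
open import Algebra.Bundles using (Ring)
open import Data.Nat as ℕ using (ℕ; zero; suc; _∸_)
open import Data.Integer as ℤ using (ℤ; +_; _≤ᵇ_)
open import Data.Integer.Properties using () renaming (_≟_ to _≟ℤ_)
open import Data.List using (List; []; _∷_; map; foldr; concatMap; length; upTo)
open import Data.Bool.ListAction using (all)
open import Data.Bool using (Bool; true; false; _∧_; not; if_then_else_)
open import Relation.Nullary using (does)

-- Walks on ℤ: a walk of length l is a start point α₀ together with its
-- list of l steps  αᵢ - αᵢ₋₁ ∈ {-1,0,1}.

data Step : Set where
  down stay up : Step

stepℤ : Step → ℤ
stepℤ down = ℤ.- (+ 1)
stepℤ stay = + 0
stepℤ up   = + 1

allSteps : ℕ → List (List Step)
allSteps zero    = [] ∷ []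
allSteps (suc n) = concatMap (λ s → map (s ∷_) (allSteps n)) (down ∷ stay ∷ up ∷ [])

pos : ℤ → List Step → ℕ → ℤ
pos a []       i       = a
pos a (s ∷ ss) zero    = a
pos a (s ∷ ss) (suc i) = pos (a ℤ.+ stepℤ s) ss i

_==_ : ℤ → ℤ → Bool
x == y = does (x ≟ℤ y)

endsAt : ℤ → List Step → ℤ → Bool
endsAt a ss b = pos a ss (length ss) == b

standard : ℤ → List Step → Bool
standard a ss = all (λ i → pos a ss (length ss) ≤ᵇ pos a ss i) (upTo (suc (length ss)))

isPrimitive : ℤ → List Step → Bool
isPrimitive a []         = false
isPrimitive a ss@(_ ∷ _) =
  (pos a ss (length ss) == a) ∧
  all (λ i → not (pos a ss i == a)) (map suc (upTo (length ss ∸ 1)))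

-- Formal power series Λ[[z]] over a (not necessarily commutative) ring,
-- represented by their coefficient sequences.

module PowerSeries {c ℓ : Level} (R : Ring c ℓ) where
  open Ring R

  infix 4 _≋_
  infixl 6 _+ₛ_ _-ₛ_
  infixl 7 _*ₛ_
  infixr 8 _^ₛ_

  Series : Set c
  Series = ℕ → Carrier

  _≋_ : Series → Series → Set ℓ
  f ≋ g = ∀ n → f n ≈ g n

  sumTo : ℕ → (ℕ → Carrier) → Carrier
  sumTo zero    f = f 0
  sumTo (suc n) f = sumTo n f + f (suc n)

  sumList : List Carrier → Carrier
  sumList = foldr _+_ 0#

  1ₛ : Series
  1ₛ zero    = 1#
  1ₛ (suc n) = 0#

  _+ₛ_ : Series → Series → Series
  (f +ₛ g) n = f n + g n

  _-ₛ_ : Series → Series → Series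
  (f -ₛ g) n = f n - g n

  _*ₛ_ : Series → Series → Series
  (f *ₛ g) n = sumTo n (λ i → f i * g (n ∸ i))

  _^ₛ_ : Series → ℕ → Series
  f ^ₛ zero  = 1ₛ
  f ^ₛ suc k = f *ₛ (f ^ₛ k)

  -- 1 + J + J² + ⋯ , for J with zero constant term: the coefficient of zⁿ
  -- only receives contributions from J⁰,…,Jⁿ.
  geomSeries : Series → Series
  geomSeries J n = sumTo n (λ k → (J ^ₛ k) n)

module Walks {c ℓ : Level} (R : Ring c ℓ) (A B C : Ring.Carrier R) where
  open Ring R
  open PowerSeries R

  U : Step → Carrier
  U down = A
  U stay = B
  U up   = C

  weight : List Step → Carrier
  weight = foldr (λ s r → U s * r) 1#

  walkSeries : ℤ → (List Step → Bool) → Series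
  walkSeries a P l = sumList (map (λ ss → if P ss then weight ss else 0#) (allSteps l))

  G : Series
  G = walkSeries (+ 0) (λ ss → endsAt (+ 0) ss (+ 0) ∧ standard (+ 0) ss)

  M₀ : Series
  M₀ = walkSeries (+ 0) (λ ss → endsAt (+ 0) ss (+ 0))

  M₋₁ : Series
  M₋₁ = walkSeries (ℤ.- (+ 1)) (λ ss → endsAt (ℤ.- (+ 1)) ss (+ 0))

  M₁ : Series
  M₁ = walkSeries (+ 1) (λ ss → endsAt (+ 1) ss (+ 0))

  J₀ : Series
  J₀ = walkSeries (+ 0) (λ ss → isPrimitive (+ 0) ss)

-- A walk from 0 to 0 is either empty or a primitive walk followed by a walk
-- from 0 to 0, so M₀ = 1 + J₀ M₀.  As J₀ has no constant term, unrolling this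
-- gives M₀ = Σ J₀ᵏ, and 1 - J₀ is a two-sided inverse of M₀.
-- A walk from 0 to 0 that is not standard goes below 0; cutting it at its first
-- visit to -1 gives G = M₀ - F M₋₁, where F counts the walks from 0 whose first
-- visit to -1 is their last step.  Translating by 1, F also counts the walks
-- from 1 first reaching 0 at their end, and cutting walks from 1 to 0 at their
-- first visit to 0 gives M₁ = F M₀, i.e. F = M₁ M₀⁻¹.

module Submission where

open import Level using (Level)
open import Algebra.Bundles using (Ring; CommutativeMonoid)
open import Data.Bool using (Bool; true; false; _∧_; not; if_then_else_)
open import Data.Bool.Properties using (∧-identityʳ; ∧-commutativeMonoid)
open import Data.Bool.ListAction using (all; and)
open import Data.Integer as ℤ using (ℤ; +_; -[1+_]; -1ℤ; _≤ᵇ_; -≤-; -≤+)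
open import Data.Integer.Properties as ℤ using (_≟_)
open import Data.List using (List; []; _∷_; map; _++_; length; upTo)
open import Data.List.Properties using (map-∘; map-cong; map-upTo)
open import Data.Nat as ℕ using (ℕ; zero; suc; _∸_; z≤n; s≤s)
open import Data.Nat.Properties using (≤-refl; ≤-trans; ≤-<-trans; m∸n≤m; m≤n⇒m≤1+n)
open import Data.Product using (Σ-syntax; _×_; _,_)
open import Function.Bundles using (mk⇔)
open import Relation.Binary.PropositionalEquality as ≡ using (_≡_)
open import Relation.Nullary using (¬_; yes; no)
open import Relation.Nullary.Decidable using (dec-true; dec-false; does-⇔)

open import Algebra.Properties.CommutativeSemigroup
  (CommutativeMonoid.commutativeSemigroup ∧-commutativeMonoid) using (x∙yz≈y∙xz)
open import Algebra.Properties.CommutativeSemigroup ℤ.+-commutativeSemigroup using (xy∙z≈xz∙y)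
open import Algebra.Properties.AbelianGroup ℤ.+-0-abelianGroup using (∙-cancelʳ)

open import Defs

module SeriesProperties {c ℓ : Level} (R : Ring c ℓ) where
  open Ring R
  open PowerSeries R
  open import Algebra.Properties.Ring R
    using (-0#≈0#; -‿+-comm; [y-z]x≈yx-zx; x[y-z]≈xy-xz; x∙y⁻¹≈ε⇒x≈y; //-rightDividesʳ)
  open import Algebra.Properties.CommutativeSemigroup +-commutativeSemigroup
    using (interchange)
  open import Relation.Binary.Reasoning.Setoid setoid

  sumTo-cong : ∀ n {f g : ℕ → Carrier} → (∀ i → f i ≈ g i) → sumTo n f ≈ sumTo n g
  sumTo-cong zero    f≈g = f≈g 0
  sumTo-cong (suc n) f≈g = +-cong (sumTo-cong n f≈g) (f≈g (suc n))

  sumTo-zero : ∀ n {f : ℕ → Carrier} → (∀ i → i ℕ.≤ n → f i ≈ 0#) → sumTo n f ≈ 0#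
  sumTo-zero zero    f≈0 = f≈0 0 z≤n
  sumTo-zero (suc n) f≈0 = begin
    sumTo n _ + _ ≈⟨ +-cong (sumTo-zero n (λ i i≤n → f≈0 i (m≤n⇒m≤1+n i≤n))) (f≈0 (suc n) ≤-refl) ⟩
    0# + 0#       ≈⟨ +-identityˡ 0# ⟩
    0#            ∎

  sumTo-+ : ∀ n (f g : ℕ → Carrier) → sumTo n (λ i → f i + g i) ≈ sumTo n f + sumTo n g
  sumTo-+ zero    f g = refl
  sumTo-+ (suc n) f g = trans (+-congʳ (sumTo-+ n f g)) (interchange _ _ _ _)

  sumTo-- : ∀ n (f g : ℕ → Carrier) → sumTo n (λ i → f i - g i) ≈ sumTo n f - sumTo n g
  sumTo-- n f g = trans (sumTo-+ n f (λ i → - g i)) (+-congˡ (sumTo-neg n))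
    where
    sumTo-neg : ∀ n → sumTo n (λ i → - g i) ≈ - sumTo n g
    sumTo-neg zero    = refl
    sumTo-neg (suc n) = trans (+-congʳ (sumTo-neg n)) (-‿+-comm _ _)

  sumTo-*ˡ : ∀ n x (f : ℕ → Carrier) → sumTo n (λ i → x * f i) ≈ x * sumTo n f
  sumTo-*ˡ zero    x f = refl
  sumTo-*ˡ (suc n) x f = trans (+-congʳ (sumTo-*ˡ n x f)) (sym (distribˡ x _ _))

  sumTo-sucˡ : ∀ n (f : ℕ → Carrier) → sumTo (suc n) f ≈ f 0 + sumTo n (λ i → f (suc i))
  sumTo-sucˡ zero    f = refl
  sumTo-sucˡ (suc n) f = trans (+-congʳ (sumTo-sucˡ n f)) (+-assoc _ _ _)

  sumTo-comm : ∀ n m (h : ℕ → ℕ → Carrier) →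
               sumTo n (λ i → sumTo m (h i)) ≈ sumTo m (λ k → sumTo n (λ i → h i k))
  sumTo-comm zero    m h = refl
  sumTo-comm (suc n) m h = trans (+-congʳ (sumTo-comm n m h)) (sym (sumTo-+ m _ _))

  shift : Series → Series
  shift f i = f (suc i)

  infixr 7 _·ₛ_

  _·ₛ_ : Carrier → Series → Series
  (x ·ₛ f) n = x * f n

  *ₛ-cong : ∀ {f f′ g g′} → f ≋ f′ → g ≋ g′ → f *ₛ g ≋ f′ *ₛ g′
  *ₛ-cong f≋f′ g≋g′ n = sumTo-cong n (λ i → *-cong (f≋f′ i) (g≋g′ (n ∸ i)))

  *ₛ-congˡ : ∀ f {g g′} → g ≋ g′ → f *ₛ g ≋ f *ₛ g′
  *ₛ-congˡ f = *ₛ-cong {f} (λ _ → refl)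

  *ₛ-congʳ : ∀ {f f′} g → f ≋ f′ → f *ₛ g ≋ f′ *ₛ g
  *ₛ-congʳ g f≋f′ = *ₛ-cong {g = g} f≋f′ (λ _ → refl)

  *ₛ-suc : ∀ f g n → (f *ₛ g) (suc n) ≈ f 0 * g (suc n) + (shift f *ₛ g) n
  *ₛ-suc f g n = sumTo-sucˡ n _

  *ₛ-suc-shift : ∀ {f} g n → f 0 ≈ 0# → (f *ₛ g) (suc n) ≈ (shift f *ₛ g) n
  *ₛ-suc-shift {f} g n f0≈0 = begin
    (f *ₛ g) (suc n)                   ≈⟨ *ₛ-suc f g n ⟩
    f 0 * g (suc n) + (shift f *ₛ g) n ≈⟨ +-congʳ (trans (*-congʳ f0≈0) (zeroˡ _)) ⟩
    0# + (shift f *ₛ g) n              ≈⟨ +-identityˡ _ ⟩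
    (shift f *ₛ g) n                   ∎

  *ₛ-distribʳ-+ : ∀ f g h → (f +ₛ g) *ₛ h ≋ f *ₛ h +ₛ g *ₛ h
  *ₛ-distribʳ-+ f g h n = trans (sumTo-cong n (λ i → distribʳ _ _ _)) (sumTo-+ n _ _)

  *ₛ-distribˡ-+ : ∀ f g h → f *ₛ (g +ₛ h) ≋ f *ₛ g +ₛ f *ₛ h
  *ₛ-distribˡ-+ f g h n = trans (sumTo-cong n (λ i → distribˡ _ _ _)) (sumTo-+ n _ _)

  *ₛ-distribʳ-- : ∀ f g h → (f -ₛ g) *ₛ h ≋ f *ₛ h -ₛ g *ₛ h
  *ₛ-distribʳ-- f g h n = trans (sumTo-cong n (λ i → [y-z]x≈yx-zx _ _ _)) (sumTo-- n _ _)

  *ₛ-distribˡ-- : ∀ f g h → f *ₛ (g -ₛ h) ≋ f *ₛ g -ₛ f *ₛ h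
  *ₛ-distribˡ-- f g h n = trans (sumTo-cong n (λ i → x[y-z]≈xy-xz _ _ _)) (sumTo-- n _ _)

  *ₛ-identityˡ : ∀ f → 1ₛ *ₛ f ≋ f
  *ₛ-identityˡ f zero    = *-identityˡ _
  *ₛ-identityˡ f (suc n) = begin
    (1ₛ *ₛ f) (suc n)                 ≈⟨ *ₛ-suc 1ₛ f n ⟩
    1# * f (suc n) + (shift 1ₛ *ₛ f) n ≈⟨ +-cong (*-identityˡ _) (sumTo-zero n (λ i _ → zeroˡ _)) ⟩
    f (suc n) + 0#                    ≈⟨ +-identityʳ _ ⟩
    f (suc n)                         ∎

  *ₛ-identityʳ : ∀ f → f *ₛ 1ₛ ≋ f
  *ₛ-identityʳ f zero    = *-identityʳ _
  *ₛ-identityʳ f (suc n) = begin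
    (f *ₛ 1ₛ) (suc n)                  ≈⟨ *ₛ-suc f 1ₛ n ⟩
    f 0 * 0# + (shift f *ₛ 1ₛ) n       ≈⟨ +-cong (zeroʳ _) (*ₛ-identityʳ (shift f) n) ⟩
    0# + f (suc n)                     ≈⟨ +-identityˡ _ ⟩
    f (suc n)                          ∎

  ·ₛ-*ₛ : ∀ x f g → (x ·ₛ f) *ₛ g ≋ x ·ₛ (f *ₛ g)
  ·ₛ-*ₛ x f g n = trans (sumTo-cong n (λ i → *-assoc _ _ _)) (sumTo-*ˡ n x _)

  *ₛ-assoc : ∀ f g h → (f *ₛ g) *ₛ h ≋ f *ₛ (g *ₛ h)
  *ₛ-assoc f g h zero    = *-assoc _ _ _
  *ₛ-assoc f g h (suc n) = begin
    ((f *ₛ g) *ₛ h) (suc n)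
      ≈⟨ *ₛ-suc (f *ₛ g) h n ⟩
    f 0 * g 0 * h (suc n) + (shift (f *ₛ g) *ₛ h) n
      ≈⟨ +-congˡ (*ₛ-congʳ h (λ m → *ₛ-suc f g m) n) ⟩
    f 0 * g 0 * h (suc n) + ((f 0 ·ₛ shift g +ₛ shift f *ₛ g) *ₛ h) n
      ≈⟨ +-congˡ (*ₛ-distribʳ-+ (f 0 ·ₛ shift g) (shift f *ₛ g) h n) ⟩
    f 0 * g 0 * h (suc n) + (((f 0 ·ₛ shift g) *ₛ h) n + ((shift f *ₛ g) *ₛ h) n)
      ≈⟨ +-cong (*-assoc _ _ _) (+-cong (·ₛ-*ₛ (f 0) (shift g) h n) (*ₛ-assoc (shift f) g h n)) ⟩
    f 0 * (g 0 * h (suc n)) + (f 0 * (shift g *ₛ h) n + (shift f *ₛ (g *ₛ h)) n)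
      ≈⟨ +-assoc _ _ _ ⟨
    f 0 * (g 0 * h (suc n)) + f 0 * (shift g *ₛ h) n + (shift f *ₛ (g *ₛ h)) n
      ≈⟨ +-congʳ (trans (*-congˡ (*ₛ-suc g h n)) (distribˡ _ _ _)) ⟨
    f 0 * (g *ₛ h) (suc n) + (shift f *ₛ (g *ₛ h)) n
      ≈⟨ *ₛ-suc f (g *ₛ h) n ⟨
    (f *ₛ (g *ₛ h)) (suc n) ∎

  *ₛ-sumTo : ∀ m f (g : ℕ → Series) →
             f *ₛ (λ k → sumTo m (λ j → g j k)) ≋ (λ k → sumTo m (λ j → (f *ₛ g j) k))
  *ₛ-sumTo m f g n = trans (sumTo-cong n (λ i → sym (sumTo-*ˡ m _ _))) (sumTo-comm n m _)

  unitConstant-*ₛ-cancelˡ : ∀ {X E} → X 0 ≈ 1# → (∀ n → (X *ₛ E) n ≈ 0#) → ∀ n → E n ≈ 0#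
  unitConstant-*ₛ-cancelˡ {X} {E} X0≈1 XE≈0 n = vanishes n n ≤-refl
    where
    X0*x≈x : ∀ x → X 0 * x ≈ x
    X0*x≈x x = trans (*-congʳ X0≈1) (*-identityˡ x)

    vanishes : ∀ m k → k ℕ.≤ m → E k ≈ 0#
    vanishes m       zero    _         = trans (sym (X0*x≈x (E 0))) (XE≈0 0)
    vanishes (suc m) (suc k) (s≤s k≤m) = begin
      E (suc k)                           ≈⟨ +-identityʳ _ ⟨
      E (suc k) + 0#                      ≈⟨ +-cong (X0*x≈x _) (sumTo-zero k tail≈0) ⟨
      X 0 * E (suc k) + (shift X *ₛ E) k  ≈⟨ *ₛ-suc X E k ⟨
      (X *ₛ E) (suc k)                    ≈⟨ XE≈0 (suc k) ⟩
      0#                                  ∎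
      where
      tail≈0 : ∀ i → i ℕ.≤ k → X (suc i) * E (k ∸ i) ≈ 0#
      tail≈0 i _ = trans (*-congˡ (vanishes m (k ∸ i) (≤-trans (m∸n≤m k i) k≤m))) (zeroʳ _)

  inverseˡ⇒inverseʳ : ∀ {X M} → X 0 ≈ 1# → X *ₛ M ≋ 1ₛ → M *ₛ X ≋ 1ₛ
  inverseˡ⇒inverseʳ {X} {M} X0≈1 XM≈1 n =
    x∙y⁻¹≈ε⇒x≈y _ _ (unitConstant-*ₛ-cancelˡ {E = M *ₛ X -ₛ 1ₛ} X0≈1 X[MX-1]≈0 n)
    where
    X[MX-1]≈0 : ∀ k → (X *ₛ (M *ₛ X -ₛ 1ₛ)) k ≈ 0#
    X[MX-1]≈0 k = begin
      (X *ₛ (M *ₛ X -ₛ 1ₛ)) k          ≈⟨ *ₛ-distribˡ-- X (M *ₛ X) 1ₛ k ⟩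
      (X *ₛ (M *ₛ X)) k - (X *ₛ 1ₛ) k  ≈⟨ +-congʳ (*ₛ-assoc X M X k) ⟨
      (X *ₛ M *ₛ X) k - (X *ₛ 1ₛ) k    ≈⟨ +-cong (trans (*ₛ-congʳ X XM≈1 k) (*ₛ-identityˡ X k))
                                                  (-‿cong (*ₛ-identityʳ X k)) ⟩
      X k - X k                        ≈⟨ -‿inverseʳ (X k) ⟩
      0#                               ∎

  fixpoint-inverseˡ : ∀ {J M} → M ≋ 1ₛ +ₛ J *ₛ M → (1ₛ -ₛ J) *ₛ M ≋ 1ₛ
  fixpoint-inverseˡ {J} {M} M≋1+JM n = begin
    ((1ₛ -ₛ J) *ₛ M) n                 ≈⟨ *ₛ-distribʳ-- 1ₛ J M n ⟩
    (1ₛ *ₛ M) n - (J *ₛ M) n           ≈⟨ +-congʳ (trans (*ₛ-identityˡ M n) (M≋1+JM n)) ⟩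
    1ₛ n + (J *ₛ M) n - (J *ₛ M) n     ≈⟨ //-rightDividesʳ _ _ ⟩
    1ₛ n                               ∎

  fixpoint-inverseʳ : ∀ {J M} → J 0 ≈ 0# → M ≋ 1ₛ +ₛ J *ₛ M → M *ₛ (1ₛ -ₛ J) ≋ 1ₛ
  fixpoint-inverseʳ {J} J0≈0 M≋1+JM =
    inverseˡ⇒inverseʳ [1-J]0≈1 (fixpoint-inverseˡ M≋1+JM)
    where
    [1-J]0≈1 : 1# - J 0 ≈ 1#
    [1-J]0≈1 = trans (+-congˡ (trans (-‿cong J0≈0) -0#≈0#)) (+-identityʳ 1#)

  ^ₛ-vanishes-below : ∀ {J} → J 0 ≈ 0# → ∀ k i → i ℕ.< k → (J ^ₛ k) i ≈ 0#
  ^ₛ-vanishes-below {J} J0≈0 (suc k) zero    _         = trans (*-congʳ J0≈0) (zeroˡ _)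
  ^ₛ-vanishes-below {J} J0≈0 (suc k) (suc i) (s≤s i<k) = begin
    (J *ₛ J ^ₛ k) (suc i)     ≈⟨ *ₛ-suc-shift (J ^ₛ k) i J0≈0 ⟩
    (shift J *ₛ J ^ₛ k) i     ≈⟨ sumTo-zero i (λ j _ → trans (*-congˡ (lower j)) (zeroʳ _)) ⟩
    0#                        ∎
    where
    lower : ∀ j → (J ^ₛ k) (i ∸ j) ≈ 0#
    lower j = ^ₛ-vanishes-below J0≈0 k (i ∸ j) (≤-<-trans (m∸n≤m i j) i<k)

  fixpoint-geomSeries : ∀ {J M} → J 0 ≈ 0# → M ≋ 1ₛ +ₛ J *ₛ M → M ≋ geomSeries J
  fixpoint-geomSeries {J} {M} J0≈0 M≋1+JM n = begin
    M n                                       ≈⟨ unroll n n ⟩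
    geomSeries J n + (J ^ₛ suc n *ₛ M) n      ≈⟨ +-congˡ (sumTo-zero n high≈0) ⟩
    geomSeries J n + 0#                       ≈⟨ +-identityʳ _ ⟩
    geomSeries J n                            ∎
    where
    partial : ℕ → Series
    partial m k = sumTo m (λ j → (J ^ₛ j) k)

    unroll : ∀ m → M ≋ partial m +ₛ J ^ₛ suc m *ₛ M
    unroll zero k = trans (M≋1+JM k) (+-congˡ (*ₛ-congʳ M (λ i → sym (*ₛ-identityʳ J i)) k))
    unroll (suc m) k = begin
      M k
        ≈⟨ M≋1+JM k ⟩
      1ₛ k + (J *ₛ M) k
        ≈⟨ +-congˡ (*ₛ-congˡ J (unroll m) k) ⟩
      1ₛ k + (J *ₛ (partial m +ₛ J ^ₛ suc m *ₛ M)) k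
        ≈⟨ +-congˡ (*ₛ-distribˡ-+ J (partial m) (J ^ₛ suc m *ₛ M) k) ⟩
      1ₛ k + ((J *ₛ partial m) k + (J *ₛ (J ^ₛ suc m *ₛ M)) k)
        ≈⟨ +-congˡ (+-cong (*ₛ-sumTo m J (J ^ₛ_) k) (sym (*ₛ-assoc J (J ^ₛ suc m) M k))) ⟩
      1ₛ k + (sumTo m (λ j → (J ^ₛ suc j) k) + (J ^ₛ suc (suc m) *ₛ M) k)
        ≈⟨ +-assoc _ _ _ ⟨
      1ₛ k + sumTo m (λ j → (J ^ₛ suc j) k) + (J ^ₛ suc (suc m) *ₛ M) k
        ≈⟨ +-congʳ (sumTo-sucˡ m (λ j → (J ^ₛ j) k)) ⟨
      partial (suc m) k + (J ^ₛ suc (suc m) *ₛ M) k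
        ∎

    high≈0 : ∀ i → i ℕ.≤ n → (J ^ₛ suc n) i * M (n ∸ i) ≈ 0#
    high≈0 i i≤n = trans (*-congʳ (^ₛ-vanishes-below J0≈0 (suc n) i (s≤s i≤n))) (zeroˡ _)

firstVisitAt : ℤ → List Step → ℤ → Bool
firstVisitAt a []       c = a == c
firstVisitAt a (s ∷ ss) c = not (a == c) ∧ firstVisitAt (a ℤ.+ stepℤ s) ss c

nonnegTo0 : ℤ → List Step → Bool
nonnegTo0 a []       = a == (+ 0)
nonnegTo0 a (s ∷ ss) = (+ 0 ≤ᵇ a) ∧ nonnegTo0 (a ℤ.+ stepℤ s) ss

all-map : ∀ {A B : Set} (p : B → Bool) (f : A → B) xs → all p (map f xs) ≡ all (λ x → p (f x)) xs
all-map p f xs = ≡.cong and (≡.sym (map-∘ xs))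

all-upTo-suc : ∀ (p : ℕ → Bool) n → all p (upTo (suc n)) ≡ p 0 ∧ all (λ i → p (suc i)) (upTo n)
all-upTo-suc p n = ≡.trans (≡.cong (λ xs → p 0 ∧ all p xs) (≡.sym (map-upTo suc n)))
                           (≡.cong (p 0 ∧_) (all-map p suc (upTo n)))

==-refl : ∀ a → (a == a) ≡ true
==-refl a = dec-true (a ≟ a) ≡.refl

==-∧-subst : ∀ (f : ℤ → Bool) a b → (a == b) ∧ f a ≡ (a == b) ∧ f b
==-∧-subst f a b with a ≟ b
... | yes ≡.refl = ≡.refl
... | no _     = ≡.refl

==-+ʳ : ∀ a c d → (a == c) ≡ ((a ℤ.+ d) == (c ℤ.+ d))
==-+ʳ a c d = does-⇔ (mk⇔ (≡.cong (ℤ._+ d)) (∙-cancelʳ d a c)) (a ≟ c) (a ℤ.+ d ≟ c ℤ.+ d)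

firstVisitAt-spec : ∀ a ss c →
  firstVisitAt a ss c ≡ endsAt a ss c ∧ all (λ i → not (pos a ss i == c)) (upTo (length ss))
firstVisitAt-spec a []       c = ≡.sym (∧-identityʳ _)
firstVisitAt-spec a (s ∷ ss) c = begin
  not (a == c) ∧ firstVisitAt a′ ss c
    ≡⟨ ≡.cong (not (a == c) ∧_) (firstVisitAt-spec a′ ss c) ⟩
  not (a == c) ∧ (endsAt a′ ss c ∧ all avoids′ (upTo (length ss)))
    ≡⟨ x∙yz≈y∙xz (not (a == c)) (endsAt a′ ss c) _ ⟩
  endsAt a′ ss c ∧ (not (a == c) ∧ all avoids′ (upTo (length ss)))
    ≡⟨ ≡.cong (endsAt a′ ss c ∧_) (all-upTo-suc (λ i → not (pos a (s ∷ ss) i == c)) (length ss)) ⟨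
  endsAt a (s ∷ ss) c ∧ all (λ i → not (pos a (s ∷ ss) i == c)) (upTo (length (s ∷ ss)))
    ∎
  where
  open ≡.≡-Reasoning
  a′ = a ℤ.+ stepℤ s
  avoids′ = λ i → not (pos a′ ss i == c)

isPrimitive-∷ : ∀ a s ss → isPrimitive a (s ∷ ss) ≡ firstVisitAt (a ℤ.+ stepℤ s) ss a
isPrimitive-∷ a s ss = ≡.trans
  (≡.cong (endsAt (a ℤ.+ stepℤ s) ss a ∧_)
          (all-map (λ i → not (pos a (s ∷ ss) i == a)) suc (upTo (length ss))))
  (≡.sym (firstVisitAt-spec (a ℤ.+ stepℤ s) ss a))

nonnegTo0-spec : ∀ a ss →
  nonnegTo0 a ss ≡ endsAt a ss (+ 0) ∧ all (λ i → + 0 ≤ᵇ pos a ss i) (upTo (suc (length ss)))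
nonnegTo0-spec a [] = ≡.sym (≡.trans (==-∧-subst (λ x → (+ 0 ≤ᵇ x) ∧ true) a (+ 0)) (∧-identityʳ _))
nonnegTo0-spec a (s ∷ ss) = begin
  (+ 0 ≤ᵇ a) ∧ nonnegTo0 a′ ss
    ≡⟨ ≡.cong ((+ 0 ≤ᵇ a) ∧_) (nonnegTo0-spec a′ ss) ⟩
  (+ 0 ≤ᵇ a) ∧ (endsAt a′ ss (+ 0) ∧ all nonneg′ (upTo (suc (length ss))))
    ≡⟨ x∙yz≈y∙xz (+ 0 ≤ᵇ a) (endsAt a′ ss (+ 0)) _ ⟩
  endsAt a′ ss (+ 0) ∧ ((+ 0 ≤ᵇ a) ∧ all nonneg′ (upTo (suc (length ss))))
    ≡⟨ ≡.cong (endsAt a′ ss (+ 0) ∧_)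
              (all-upTo-suc (λ i → + 0 ≤ᵇ pos a (s ∷ ss) i) (suc (length ss))) ⟨
  endsAt a (s ∷ ss) (+ 0) ∧ all (λ i → + 0 ≤ᵇ pos a (s ∷ ss) i) (upTo (suc (length (s ∷ ss))))
    ∎
  where
  open ≡.≡-Reasoning
  a′ = a ℤ.+ stepℤ s
  nonneg′ = λ i → + 0 ≤ᵇ pos a′ ss i

endsAt0∧standard≡nonnegTo0 : ∀ a ss → endsAt a ss (+ 0) ∧ standard a ss ≡ nonnegTo0 a ss
endsAt0∧standard≡nonnegTo0 a ss = ≡.trans
  (==-∧-subst (λ e → all (λ i → e ≤ᵇ pos a ss i) (upTo (suc (length ss))))
              (pos a ss (length ss)) (+ 0))
  (≡.sym (nonnegTo0-spec a ss))

firstVisitAt-+ : ∀ a ss c d → firstVisitAt a ss c ≡ firstVisitAt (a ℤ.+ d) ss (c ℤ.+ d)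
firstVisitAt-+ a []       c d = ==-+ʳ a c d
firstVisitAt-+ a (s ∷ ss) c d = ≡.cong₂ (λ x y → not x ∧ y) (==-+ʳ a c d)
  (≡.trans (firstVisitAt-+ (a ℤ.+ stepℤ s) ss c d)
         (≡.cong (λ x → firstVisitAt x ss (c ℤ.+ d)) (xy∙z≈xz∙y a (stepℤ s) d)))


module WalkSeriesProperties {c ℓ : Level} (R : Ring c ℓ) (A B C : Ring.Carrier R) where
  open Ring R
  open PowerSeries R
  open Walks R A B C
  open SeriesProperties R
  open import Algebra.Properties.Ring R using (//-rightDividesʳ)
  open import Algebra.Properties.CommutativeSemigroup +-commutativeSemigroup using (interchange)
  open import Relation.Binary.Reasoning.Setoid setoid

  paths : ℤ → ℤ → Series
  paths a b = walkSeries a (λ ss → endsAt a ss b)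

  firstPassages : ℤ → ℤ → Series
  firstPassages a c = walkSeries a (λ ss → firstVisitAt a ss c)

  nonnegPaths : ℤ → Series
  nonnegPaths a = walkSeries a (nonnegTo0 a)

  stepSum : (Step → Carrier) → Carrier
  stepSum g = U down * g down + U stay * g stay + U up * g up

  stepSum-cong : ∀ {g h} → (∀ s → g s ≈ h s) → stepSum g ≈ stepSum h
  stepSum-cong g≈h = +-cong (+-cong (*-congˡ (g≈h down)) (*-congˡ (g≈h stay))) (*-congˡ (g≈h up))

  stepSum-zero : ∀ g → (∀ s → g s ≈ 0#) → stepSum g ≈ 0#
  stepSum-zero g g≈0 = begin
    stepSum g                    ≈⟨ stepSum-cong {g} g≈0 ⟩
    A * 0# + B * 0# + C * 0#     ≈⟨ +-cong (+-cong (zeroʳ A) (zeroʳ B)) (zeroʳ C) ⟩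
    0# + 0# + 0#                 ≈⟨ trans (+-identityʳ _) (+-identityʳ 0#) ⟩
    0#                           ∎

  stepSum-+ : ∀ g h → stepSum (λ s → g s + h s) ≈ stepSum g + stepSum h
  stepSum-+ g h = begin
    A * (g down + h down) + B * (g stay + h stay) + C * (g up + h up)
      ≈⟨ +-cong (+-cong (distribˡ _ _ _) (distribˡ _ _ _)) (distribˡ _ _ _) ⟩
    (A * g down + A * h down) + (B * g stay + B * h stay) + (C * g up + C * h up)
      ≈⟨ +-congʳ (interchange _ _ _ _) ⟩
    (A * g down + B * g stay) + (A * h down + B * h stay) + (C * g up + C * h up)
      ≈⟨ interchange _ _ _ _ ⟩
    stepSum g + stepSum h ∎

  stepSum-sumTo : ∀ m (h : Step → ℕ → Carrier) →
                  stepSum (λ s → sumTo m (h s)) ≈ sumTo m (λ i → stepSum (λ s → h s i))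
  stepSum-sumTo m h = begin
    A * sumTo m (h down) + B * sumTo m (h stay) + C * sumTo m (h up)
      ≈⟨ +-cong (+-cong (sumTo-*ˡ m A _) (sumTo-*ˡ m B _)) (sumTo-*ˡ m C _) ⟨
    sumTo m (λ i → A * h down i) + sumTo m (λ i → B * h stay i) + sumTo m (λ i → C * h up i)
      ≈⟨ trans (sumTo-+ m _ _) (+-congʳ (sumTo-+ m _ _)) ⟨
    sumTo m (λ i → stepSum (λ s → h s i)) ∎

  stepSum-*ʳ : ∀ g y → stepSum (λ s → g s * y) ≈ stepSum g * y
  stepSum-*ʳ g y = begin
    A * (g down * y) + B * (g stay * y) + C * (g up * y)
      ≈⟨ +-cong (+-cong (*-assoc _ _ _) (*-assoc _ _ _)) (*-assoc _ _ _) ⟨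
    A * g down * y + B * g stay * y + C * g up * y
      ≈⟨ trans (distribʳ _ _ _) (+-congʳ (distribʳ _ _ _)) ⟨
    stepSum g * y ∎

  stepSum-*ₛ : ∀ (H : Step → Series) Y →
               (λ m → stepSum (λ s → (H s *ₛ Y) m)) ≋ (λ i → stepSum (λ s → H s i)) *ₛ Y
  stepSum-*ₛ H Y m = trans (stepSum-sumTo m (λ s i → H s i * Y (m ∸ i)))
                           (sumTo-cong m (λ i → stepSum-*ʳ (λ s → H s i) (Y (m ∸ i))))

  if-*ˡ : ∀ b x y → (if b then x * y else 0#) ≈ x * (if b then y else 0#)
  if-*ˡ true  x y = refl
  if-*ˡ false x y = sym (zeroʳ x)

  sumList-map-++ : ∀ (f : List Step → Carrier) xs ys →
                   sumList (map f (xs ++ ys)) ≈ sumList (map f xs) + sumList (map f ys)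
  sumList-map-++ f []       ys = sym (+-identityˡ _)
  sumList-map-++ f (x ∷ xs) ys = trans (+-congˡ (sumList-map-++ f xs ys)) (sym (+-assoc _ _ _))

  walkSeries-suc : ∀ a Q l → walkSeries a Q (suc l) ≈
                   stepSum (λ s → walkSeries (a ℤ.+ stepℤ s) (λ ss → Q (s ∷ ss)) l)
  walkSeries-suc a Q l = begin
    sumList (map term (map (down ∷_) L ++ (map (stay ∷_) L ++ (map (up ∷_) L ++ []))))
      ≈⟨ sumList-map-++ term (map (down ∷_) L) _ ⟩
    branch down + sumList (map term (map (stay ∷_) L ++ (map (up ∷_) L ++ [])))
      ≈⟨ +-congˡ (sumList-map-++ term (map (stay ∷_) L) _) ⟩
    branch down + (branch stay + sumList (map term (map (up ∷_) L ++ [])))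
      ≈⟨ +-congˡ (+-congˡ (trans (sumList-map-++ term (map (up ∷_) L) []) (+-identityʳ _))) ⟩
    branch down + (branch stay + branch up)
      ≈⟨ +-assoc _ _ _ ⟨
    branch down + branch stay + branch up
      ≈⟨ +-cong (+-cong (first-step down L) (first-step stay L)) (first-step up L) ⟩
    stepSum (λ s → walkSeries (a ℤ.+ stepℤ s) (λ ss → Q (s ∷ ss)) l) ∎
    where
    L = allSteps l
    term = λ ss → if Q ss then weight ss else 0#
    branch = λ s → sumList (map term (map (s ∷_) L))

    first-step : ∀ s xs → sumList (map term (map (s ∷_) xs)) ≈
                 U s * sumList (map (λ ss → if Q (s ∷ ss) then weight ss else 0#) xs)
    first-step s []        = sym (zeroʳ _)
    first-step s (ss ∷ xs) =
      trans (+-cong (if-*ˡ (Q (s ∷ ss)) (U s) (weight ss)) (first-step s xs)) (sym (distribˡ _ _ _))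

  -- The start point of walkSeries only matters through the predicate.
  walkSeries-cong : ∀ a b {Q Q′} → (∀ ss → Q ss ≡ Q′ ss) → walkSeries a Q ≋ walkSeries b Q′
  walkSeries-cong a b Q≡Q′ l = reflexive (≡.cong sumList
    (map-cong (λ ss → ≡.cong (λ x → if x then weight ss else 0#) (Q≡Q′ ss)) (allSteps l)))

  walkSeries-false : ∀ a Q → (∀ ss → Q ss ≡ false) → ∀ l → walkSeries a Q l ≈ 0#
  walkSeries-false a Q Q≡false l = trans (walkSeries-cong a a Q≡false l) (zeros (allSteps l))
    where
    zeros : ∀ xs → sumList (map (λ _ → 0#) xs) ≈ 0#
    zeros []       = refl
    zeros (_ ∷ xs) = trans (+-identityˡ _) (zeros xs)

  walkSeries-[]-true : ∀ a Q → Q [] ≡ true → walkSeries a Q 0 ≈ 1#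
  walkSeries-[]-true a Q Q[]≡true =
    trans (+-identityʳ _) (reflexive (≡.cong (λ x → if x then 1# else 0#) Q[]≡true))

  walkSeries-[]-false : ∀ a Q → Q [] ≡ false → walkSeries a Q 0 ≈ 0#
  walkSeries-[]-false a Q Q[]≡false =
    trans (+-identityʳ _) (reflexive (≡.cong (λ x → if x then 1# else 0#) Q[]≡false))

  firstPassages-self : ∀ c → firstPassages c c ≋ 1ₛ
  firstPassages-self c zero    = walkSeries-[]-true c (λ ss → firstVisitAt c ss c) (==-refl c)
  firstPassages-self c (suc l) = trans (walkSeries-suc c _ l) (stepSum-zero _ λ s →
    walkSeries-false (c ℤ.+ stepℤ s) (λ ss → firstVisitAt c (s ∷ ss) c)
      (λ ss → ≡.cong (λ x → not x ∧ firstVisitAt (c ℤ.+ stepℤ s) ss c) (==-refl c)) l)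

  module _ {a c : ℤ} (a≢c : ¬ a ≡ c) where

    firstPassages-zero : firstPassages a c 0 ≈ 0#
    firstPassages-zero = walkSeries-[]-false a (λ ss → firstVisitAt a ss c) (dec-false (a ≟ c) a≢c)

    firstPassages-suc : ∀ l →
      firstPassages a c (suc l) ≈ stepSum (λ s → firstPassages (a ℤ.+ stepℤ s) c l)
    firstPassages-suc l = trans (walkSeries-suc a _ l) (stepSum-cong λ s →
      walkSeries-cong (a ℤ.+ stepℤ s) (a ℤ.+ stepℤ s) (λ ss →
        ≡.cong (λ x → not x ∧ firstVisitAt (a ℤ.+ stepℤ s) ss c) (dec-false (a ≟ c) a≢c)) l)

    stepSum-firstPassages-*ₛ : ∀ Y m → stepSum (λ s → (firstPassages (a ℤ.+ stepℤ s) c *ₛ Y) m) ≈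
                                       (firstPassages a c *ₛ Y) (suc m)
    stepSum-firstPassages-*ₛ Y m = begin
      stepSum (λ s → (firstPassages (a ℤ.+ stepℤ s) c *ₛ Y) m)
        ≈⟨ stepSum-*ₛ (λ s → firstPassages (a ℤ.+ stepℤ s) c) Y m ⟩
      ((λ i → stepSum (λ s → firstPassages (a ℤ.+ stepℤ s) c i)) *ₛ Y) m
        ≈⟨ *ₛ-congʳ Y (λ i → sym (firstPassages-suc i)) m ⟩
      (shift (firstPassages a c) *ₛ Y) m
        ≈⟨ *ₛ-suc-shift Y m firstPassages-zero ⟨
      (firstPassages a c *ₛ Y) (suc m) ∎

  paths-firstPassages : ∀ a b → paths a b ≋ firstPassages a b *ₛ paths b b
  paths-firstPassages a b l with a ≟ b
  ... | yes ≡.refl =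
    sym (trans (*ₛ-congʳ (paths b b) (firstPassages-self b) l) (*ₛ-identityˡ (paths b b) l))
  paths-firstPassages a b zero    | no a≢b = begin
    paths a b 0
      ≈⟨ walkSeries-[]-false a (λ ss → endsAt a ss b) (dec-false (a ≟ b) a≢b) ⟩
    0#
      ≈⟨ trans (*-congʳ (firstPassages-zero a≢b)) (zeroˡ _) ⟨
    (firstPassages a b *ₛ paths b b) 0 ∎
  paths-firstPassages a b (suc m) | no a≢b = begin
    paths a b (suc m)
      ≈⟨ walkSeries-suc a _ m ⟩
    stepSum (λ s → paths (a ℤ.+ stepℤ s) b m)
      ≈⟨ stepSum-cong (λ s → paths-firstPassages (a ℤ.+ stepℤ s) b m) ⟩
    stepSum (λ s → (firstPassages (a ℤ.+ stepℤ s) b *ₛ paths b b) m)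
      ≈⟨ stepSum-firstPassages-*ₛ a≢b (paths b b) m ⟩
    (firstPassages a b *ₛ paths b b) (suc m) ∎

  firstPassages-+ : ∀ a c d → firstPassages a c ≋ firstPassages (a ℤ.+ d) (c ℤ.+ d)
  firstPassages-+ a c d = walkSeries-cong a (a ℤ.+ d) (λ ss → firstVisitAt-+ a ss c d)

  +≢-1ℤ : ∀ n → ¬ + n ≡ -1ℤ
  +≢-1ℤ n ()

  -1≤+n+step : ∀ n s → -1ℤ ℤ.≤ + n ℤ.+ stepℤ s
  -1≤+n+step zero    down = -≤- z≤n
  -1≤+n+step (suc n) down = -≤+
  -1≤+n+step n       stay = -≤+
  -1≤+n+step n       up   = -≤+

  -- Steps have size at most 1, so a walk from a ≥ -1 that goes below 0 visits -1.
  paths-split-below : ∀ a → -1ℤ ℤ.≤ a →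
                      paths a (+ 0) ≋ nonnegPaths a +ₛ firstPassages a -1ℤ *ₛ M₋₁
  paths-split-below -[1+ 0 ] _ l = sym (begin
    nonnegPaths -1ℤ l + (firstPassages -1ℤ -1ℤ *ₛ M₋₁) l
      ≈⟨ +-cong (walkSeries-false -1ℤ (nonnegTo0 -1ℤ) never-nonneg l)
                (*ₛ-congʳ M₋₁ (firstPassages-self -1ℤ) l) ⟩
    0# + (1ₛ *ₛ M₋₁) l
      ≈⟨ trans (+-identityˡ _) (*ₛ-identityˡ M₋₁ l) ⟩
    M₋₁ l ∎)
    where
    never-nonneg : ∀ ss → nonnegTo0 -1ℤ ss ≡ false
    never-nonneg []      = ≡.refl
    never-nonneg (_ ∷ _) = ≡.refl
  paths-split-below -[1+ suc n ] (-≤- ())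
  paths-split-below (+ n) _ zero = sym (begin
    nonnegPaths (+ n) 0 + firstPassages (+ n) -1ℤ 0 * M₋₁ 0
      ≈⟨ +-congˡ (trans (*-congʳ (firstPassages-zero (+≢-1ℤ n))) (zeroˡ _)) ⟩
    nonnegPaths (+ n) 0 + 0#
      ≈⟨ +-identityʳ _ ⟩
    paths (+ n) (+ 0) 0 ∎)
  paths-split-below (+ n) _ (suc m) = begin
    paths (+ n) (+ 0) (suc m)
      ≈⟨ walkSeries-suc (+ n) _ m ⟩
    stepSum (λ s → paths (a′ s) (+ 0) m)
      ≈⟨ stepSum-cong (λ s → paths-split-below (a′ s) (-1≤+n+step n s) m) ⟩
    stepSum (λ s → nonnegPaths (a′ s) m + below s)
      ≈⟨ stepSum-+ (λ s → nonnegPaths (a′ s) m) below ⟩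
    stepSum (λ s → nonnegPaths (a′ s) m) + stepSum below
      ≈⟨ +-cong (sym (walkSeries-suc (+ n) (nonnegTo0 (+ n)) m))
                (stepSum-firstPassages-*ₛ (+≢-1ℤ n) M₋₁ m) ⟩
    nonnegPaths (+ n) (suc m) + (firstPassages (+ n) -1ℤ *ₛ M₋₁) (suc m) ∎
    where
    a′ = λ s → + n ℤ.+ stepℤ s
    below = λ s → (firstPassages (a′ s) -1ℤ *ₛ M₋₁) m

  J₀-zero : J₀ 0 ≈ 0#
  J₀-zero = walkSeries-[]-false (+ 0) (isPrimitive (+ 0)) ≡.refl

  J₀-suc : ∀ l → J₀ (suc l) ≈ stepSum (λ s → firstPassages (+ 0 ℤ.+ stepℤ s) (+ 0) l)
  J₀-suc l = trans (walkSeries-suc (+ 0) _ l) (stepSum-cong λ s →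
    walkSeries-cong (+ 0 ℤ.+ stepℤ s) (+ 0 ℤ.+ stepℤ s) (isPrimitive-∷ (+ 0) s) l)

  M₀-firstReturn : M₀ ≋ 1ₛ +ₛ J₀ *ₛ M₀
  M₀-firstReturn zero = begin
    M₀ 0                ≈⟨ +-identityʳ 1# ⟩
    1#                  ≈⟨ +-identityʳ 1# ⟨
    1# + 0#             ≈⟨ +-congˡ (trans (*-congʳ J₀-zero) (zeroˡ _)) ⟨
    1# + J₀ 0 * M₀ 0    ∎
  M₀-firstReturn (suc m) = begin
    M₀ (suc m)
      ≈⟨ walkSeries-suc (+ 0) _ m ⟩
    stepSum (λ s → paths (+ 0 ℤ.+ stepℤ s) (+ 0) m)
      ≈⟨ stepSum-cong (λ s → paths-firstPassages (+ 0 ℤ.+ stepℤ s) (+ 0) m) ⟩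
    stepSum (λ s → (firstPassages (+ 0 ℤ.+ stepℤ s) (+ 0) *ₛ M₀) m)
      ≈⟨ stepSum-*ₛ (λ s → firstPassages (+ 0 ℤ.+ stepℤ s) (+ 0)) M₀ m ⟩
    ((λ i → stepSum (λ s → firstPassages (+ 0 ℤ.+ stepℤ s) (+ 0) i)) *ₛ M₀) m
      ≈⟨ *ₛ-congʳ M₀ (λ i → sym (J₀-suc i)) m ⟩
    (shift J₀ *ₛ M₀) m
      ≈⟨ *ₛ-suc-shift M₀ m J₀-zero ⟨
    (J₀ *ₛ M₀) (suc m)
      ≈⟨ +-identityˡ _ ⟨
    (1ₛ +ₛ J₀ *ₛ M₀) (suc m) ∎

  G-decomposition : ∀ X → M₀ *ₛ X ≋ 1ₛ → G ≋ M₀ -ₛ M₁ *ₛ X *ₛ M₋₁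
  G-decomposition X M₀X≋1 n = begin
    G n
      ≈⟨ walkSeries-cong (+ 0) (+ 0) (endsAt0∧standard≡nonnegTo0 (+ 0)) n ⟩
    nonnegPaths (+ 0) n
      ≈⟨ //-rightDividesʳ _ _ ⟨
    nonnegPaths (+ 0) n + (F₀ *ₛ M₋₁) n - (F₀ *ₛ M₋₁) n
      ≈⟨ +-cong (paths-split-below (+ 0) -≤+ n) (-‿cong (*ₛ-congʳ M₋₁ M₁X≋F₀ n)) ⟨
    M₀ n - (M₁ *ₛ X *ₛ M₋₁) n ∎
    where
    F₀ = firstPassages (+ 0) -1ℤ
    F₁ = firstPassages (+ 1) (+ 0)

    M₁X≋F₀ : M₁ *ₛ X ≋ F₀
    M₁X≋F₀ k = begin
      (M₁ *ₛ X) k            ≈⟨ *ₛ-congʳ X (paths-firstPassages (+ 1) (+ 0)) k ⟩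
      (F₁ *ₛ M₀ *ₛ X) k      ≈⟨ *ₛ-assoc F₁ M₀ X k ⟩
      (F₁ *ₛ (M₀ *ₛ X)) k    ≈⟨ *ₛ-congˡ F₁ M₀X≋1 k ⟩
      (F₁ *ₛ 1ₛ) k           ≈⟨ *ₛ-identityʳ F₁ k ⟩
      F₁ k                   ≈⟨ firstPassages-+ (+ 0) -1ℤ (+ 1) k ⟨
      F₀ k                   ∎

theorem3p5 : ∀ {c ℓ} (R : Ring c ℓ) (A B C : Ring.Carrier R) →
    let open PowerSeries R
        open Walks R A B C
    in (M₀ ≋ geomSeries J₀)
       × (Σ[ M₀⁻¹ ∈ Series ] ((M₀⁻¹ *ₛ M₀ ≋ 1ₛ) × (M₀ *ₛ M₀⁻¹ ≋ 1ₛ)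
            × (G ≋ (M₀ -ₛ ((M₁ *ₛ M₀⁻¹) *ₛ M₋₁)))))
theorem3p5 R A B C =
    fixpoint-geomSeries J₀-zero M₀-firstReturn
  , 1ₛ -ₛ J₀
  , fixpoint-inverseˡ M₀-firstReturn
  , M₀-inverseʳ
  , G-decomposition (1ₛ -ₛ J₀) M₀-inverseʳ
  where
  open PowerSeries R
  open Walks R A B C
  open SeriesProperties R
  open WalkSeriesProperties R A B C

  M₀-inverseʳ : M₀ *ₛ (1ₛ -ₛ J₀) ≋ 1ₛ
  M₀-inverseʳ = fixpoint-inverseʳ J₀-zero M₀-firstReturn
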